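{- Let $A\subseteq S_n\subseteq B_n$ and set $\mathcal{Q}(A)=\sum_{w\in A}F_{\mathrm{Des}(w)}(x_1,x_2,\dots)$ and $\mathcal{Q}^C(A)=\sum_{w\in A}F^B_{\mathrm{Des}_B(w)}(x_0,x_1,\dots)$. If $\mathcal{Q}(A)$ is symmetric in $x_1,x_2,\dots$, then $\mathcal{Q}^C(A)$ is symmetric in $x_0,x_1,\dots$, and for every partition $\lambda\vdash n$, \[ \langle \mathcal{Q}^C(A), s_\lambda(x_0,x_1,\dots)\rangle=\langle\mathcal{Q}(A),s_\lambda(x_1,x_2,\dots)\rangle; \] that is, if $\mathcal{Q}(A)=\sum_{\lambda\vdash n}c_\lambda s_\lambda(x_1,x_2,\dots)$ then $\mathcal{Q}^C(A)=\sum_{\lambda\vdash n}c_\lambda s_\lambda(x_0,x_1,\dots)$.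
   Context: $B_n$ is the group of signed permutations of $\{\pm1,\dots,\pm n\}$, $w=[w_1,\dots,w_n]$ with $w_i=w(i)$, and $S_n$ is embedded as the signed permutations with all $w_i>0$. For $w\in S_n$, $\mathrm{Des}(w)=\{1\le i\le n-1\mid w_i>w_{i+1}\}$; for $w\in B_n$, $\mathrm{Des}_B(w)=\{0\le i\le n-1\mid w_i>w_{i+1}\}$ with $w_0:=0$. Gessel's fundamental quasi-symmetric function for $J\subseteq[n-1]$ is $F_J=\sum x_{i_1}\cdots x_{i_n}$ over $1\le i_1\le\cdots\le i_n$ with $i_j<i_{j+1}$ for $j\in J$. Chow's function for $J\subseteq\{0,\dots,n-1\}$ is $F^B_J=\sum x_{i_1}\cdots x_{i_n}$ over $0\le i_1\le\cdots\le i_n$ with $i_j<i_{j+1}$ for $j\in J$, where $i_0:=0$. $\langle\cdot,\cdot\rangle$ is the standard (Hall) inner product on symmetric functions, for which Schur functions in the given variables are orthonormal. -}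

module Defs where

open import Data.Bool using (Bool; true; false; _∧_; if_then_else_; T)
open import Data.Nat as ℕ using (ℕ; zero; suc; _∸_; _≤ᵇ_; _<ᵇ_)
open import Data.Nat.Properties using (≤-decTotalOrder)
open import Data.Integer as ℤ using (ℤ; +_; ∣_∣)
open import Data.List as List using (List; []; _∷_; map; upTo; filterᵇ; length; foldr; zipWith; take; drop; concatMap; applyUpTo)
open import Data.Bool.ListAction using (and)
open import Data.Nat.ListAction using (sum)
open import Data.List.Properties using (≡-dec)
open import Data.List.Relation.Unary.All using (All)
open import Data.List.Relation.Unary.Unique.Propositional using (Unique)
open import Data.List.Relation.Binary.Permutation.Propositional using (_↭_)
open import Data.Vec as Vec using (Vec; toList)
open import Data.Product using (_×_)
open import Function.Bundles using (_↔_; Inverse)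
open import Relation.Binary.PropositionalEquality using (_≡_)
open import Relation.Nullary.Decidable using (⌊_⌋)
open import Data.List.Sort.InsertionSort ≤-decTotalOrder using (sort)

IsSignedPerm : ℕ → List ℤ → Set
IsSignedPerm n w = map ∣_∣ w ↭ map suc (upTo n)

InS : ℕ → List ℤ → Set
InS n w = IsSignedPerm n w × All (λ x → ℤ.0ℤ ℤ.< x) w

-- 1-indexed lookup with the convention that position 0 holds the
-- default value d (used for w_0 := 0 and i_0 := 0).
at : {A : Set} → A → List A → ℕ → A
at d xs zero = d
at d [] (suc k) = d
at d (x ∷ xs) (suc zero) = x
at d (x ∷ xs) (suc (suc k)) = at d xs (suc k)

descentAt : List ℤ → ℕ → Bool
descentAt w i = ⌊ at ℤ.0ℤ w (suc i) ℤ.<? at ℤ.0ℤ w i ⌋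

Des : ℕ → List ℤ → List ℕ
Des n w = filterᵇ (descentAt w) (map suc (upTo (n ∸ 1)))

DesB : ℕ → List ℤ → List ℕ
DesB n w = filterᵇ (descentAt w) (upTo n)

-- A homogeneous formal power series of degree n in countably many
-- variables y_0, y_1, y_2, … is given by its coefficients: for a word
-- i = (i_1,…,i_n) ∈ ℕ^n, `f i` is the coefficient of the monomial
-- y_{i_1} ⋯ y_{i_n}.  (All series below are defined so that `f i`
-- only depends on the monomial, i.e. on the multiset of the i_j.)
Series : ℕ → Set
Series n = Vec ℕ n → ℤ

sorted : {n : ℕ} → Vec ℕ n → List ℕ
sorted i = sort (toList i)

strictAt : List ℕ → List ℕ → Bool
strictAt J i = and (map (λ j → at 0 i j <ᵇ at 0 i (suc j)) J)

-- Gessel's F_J(x_1,x_2,…), written in the variables y_k := x_{k+1}: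
-- coefficient of y_{i_1}⋯y_{i_n} is 1 iff the weakly increasing
-- rearrangement (i_1 ≤ … ≤ i_n) is strict at every j ∈ J (J ⊆ [n-1]).
F : (n : ℕ) → List ℕ → Series n
F n J i = if strictAt J (sorted i) then + 1 else + 0

-- Chow's F^B_J(x_0,x_1,…), in the variables y_k := x_k:
-- sum over 0 ≤ i_1 ≤ … ≤ i_n, strict at j ∈ J, with i_0 := 0.
FB : (n : ℕ) → List ℕ → Series n
FB n J i = if strictAt J (sorted i) then + 1 else + 0

sumℤ : List ℤ → ℤ
sumℤ = foldr ℤ._+_ ℤ.0ℤ

Q : (n : ℕ) → List (List ℤ) → Series n
Q n A i = sumℤ (map (λ w → F n (Des n w) i) A)

QC : (n : ℕ) → List (List ℤ) → Series n
QC n A i = sumℤ (map (λ w → FB n (DesB n w) i) A)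

Symmetric : {n : ℕ} → Series n → Set
Symmetric {n} f = (σ : ℕ ↔ ℕ) (i : Vec ℕ n) → f (Vec.map (Inverse.to σ) i) ≡ f i

-- partitions (weakly decreasing lists of positive parts) of m with all
-- parts ≤ k; the first argument is fuel (fuel ≥ m suffices).
partsBounded : ℕ → ℕ → ℕ → List (List ℕ)
partsBounded _ zero k = [] ∷ []
partsBounded zero (suc m) k = []
partsBounded (suc f) (suc m) k =
  concatMap (λ p → map (p ∷_) (partsBounded f (suc m ∸ p) p))
            (filterᵇ (λ p → p ≤ᵇ k) (map suc (upTo (suc m))))

partitions : ℕ → List (List ℕ)
partitions n = partsBounded n n n

words : ℕ → ℕ → List (List ℕ)
words b zero = [] ∷ []
words b (suc n) = concatMap (λ x → map (x ∷_) (words b n)) (upTo b)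

-- cut a filling (listed row by row) into the rows of shape λ
rows : List ℕ → List ℕ → List (List ℕ)
rows [] t = []
rows (l ∷ λ′) t = take l t ∷ rows λ′ (drop l t)

weaklyIncreasing : List ℕ → Bool
weaklyIncreasing [] = true
weaklyIncreasing (x ∷ []) = true
weaklyIncreasing (x ∷ y ∷ xs) = (x ≤ᵇ y) ∧ weaklyIncreasing (y ∷ xs)

columnsStrict : List (List ℕ) → Bool
columnsStrict [] = true
columnsStrict (r ∷ []) = true
columnsStrict (r ∷ r′ ∷ rs) = and (zipWith _<ᵇ_ r r′) ∧ columnsStrict (r′ ∷ rs)

isSSYT : List ℕ → List ℕ → Bool
isSSYT λ′ t = and (map weaklyIncreasing (rows λ′ t)) ∧ columnsStrict (rows λ′ t)

-- Schur function s_λ(y_0,y_1,…) = Σ_{T ∈ SSYT(λ)} y^T : the coefficient of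
-- y_{i_1}⋯y_{i_n} is the number of SSYT of shape λ whose multiset of
-- entries is {i_1,…,i_n}.  (Entries of such T are ≤ i_1+⋯+i_n.)
schur : (n : ℕ) → List ℕ → Series n
schur n λ′ i =
  + length (filterᵇ (λ t → isSSYT λ′ t ∧ ⌊ ≡-dec ℕ._≟_ (sort t) (sorted i) ⌋)
                    (words (suc (sum (toList i))) n))

schurExpansion : (n : ℕ) → (List ℕ → ℤ) → Series n
schurExpansion n c i = sumℤ (map (λ λ′ → c λ′ ℤ.* schur n λ′ i) (partitions n))

_≈_ : {n : ℕ} → Series n → Series n → Set
_≈_ {n} f g = (i : Vec ℕ n) → f i ≡ g i

-- A permutation with positive entries has no type-B descent at 0, since w₁ > 0 = w₀,
-- so Des_B(w) = Des(w).  For J ⊆ [n-1] Chow's F^B_J(x₀,x₁,…) is Gessel's F_J in the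
-- alphabet x₀,x₁,…; hence 𝒬^C(A) is 𝒬(A) with x_{k+1} renamed to x_k, a renaming
-- that preserves both symmetry and the Schur expansion.
module Submission where

open import Defs
open import Data.Nat using (ℕ; zero; suc)
open import Data.Bool using (false)
open import Data.Integer using (ℤ; 0ℤ; _<_; _<?_; _+_)
open import Data.Integer.Properties using (<-asym)
open import Data.List using (List; []; _∷_; map; filterᵇ)
open import Data.List.Properties using (map-applyUpTo)
open import Data.List.Relation.Unary.All as All using (All; []; _∷_)
open import Data.List.Relation.Unary.Unique.Propositional using (Unique)
open import Data.Product using (_×_; _,_; proj₂)
import Data.Vec as Vec
open import Function using (id)
open import Function.Bundles using (Inverse)
open import Relation.Nullary.Decidable using (isYes≗does; dec-false)
open import Relation.Binary.PropositionalEquality using (_≡_; refl; sym; trans; cong; cong₂)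

Positive : List ℤ → Set
Positive = All (0ℤ <_)

¬descentAt-zero : (w : List ℤ) → Positive w → descentAt w 0 ≡ false
¬descentAt-zero []      _         = refl
¬descentAt-zero (x ∷ w) (0<x ∷ _) =
  trans (isYes≗does (x <? 0ℤ)) (dec-false (x <? 0ℤ) (<-asym 0<x))

DesB≡Des : (n : ℕ) (w : List ℤ) → Positive w → DesB n w ≡ Des n w
DesB≡Des zero    w _     = refl
DesB≡Des (suc m) w pos-w rewrite ¬descentAt-zero w pos-w =
  cong (filterᵇ (descentAt w)) (sym (map-applyUpTo id suc m))

QC≈Q : (n : ℕ) (A : List (List ℤ)) → All Positive A → QC n A ≈ Q n A
QC≈Q n []      []            i = refl
QC≈Q n (w ∷ A) (pos-w ∷ pos) i =
  cong₂ _+_ (cong (λ J → F n J i) (DesB≡Des n w pos-w)) (QC≈Q n A pos i)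

Symmetric-resp-≈ : {n : ℕ} {f g : Series n} → f ≈ g → Symmetric g → Symmetric f
Symmetric-resp-≈ f≈g sym-g σ i =
  trans (f≈g (Vec.map (Inverse.to σ) i)) (trans (sym-g σ i) (sym (f≈g i)))

≈-trans : {n : ℕ} {f g h : Series n} → f ≈ g → g ≈ h → f ≈ h
≈-trans f≈g g≈h i = trans (f≈g i) (g≈h i)

lemma8p3 : (n : ℕ) (A : List (List ℤ)) →
    All (InS n) A → Unique A →
    Symmetric (Q n A) →
    Symmetric (QC n A) ×
      ((c : List ℕ → ℤ) → Q n A ≈ schurExpansion n c → QC n A ≈ schurExpansion n c)
lemma8p3 n A A⊆Sₙ _ sym-Q =
  Symmetric-resp-≈ QC≈Q′ sym-Q , λ c Q≈s → ≈-trans QC≈Q′ Q≈s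
  where
  QC≈Q′ : QC n A ≈ Q n A
  QC≈Q′ = QC≈Q n A (All.map proj₂ A⊆Sₙ)
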